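{- Let $c>1$ be coprime to $6$, $N>1$ coprime to $c$, $\delta=\sum_{D\mid N,D>0}n_D[\mathrm{diag}(1,D)]$ with $n_D\in\mathbb{Z}$ and $\sum_Dn_DD=0$, and $\mathscr N$ the set of primes dividing $cN$. Then $12\cdot\Psi^\delta$ is integer valued: $12\Psi^\delta([(a,b)+\mathbb{Z}^2])\in\mathbb{Z}$ for every $(a,b)\in\mathbb{Z}_{\mathscr N}^2\setminus\mathbb{Z}^2$ (and hence, by scalar invariance, on all test functions).
   Context: $\mathbb{Z}_{\mathscr N}$ is the ring of rationals integral at the primes dividing $cN$. Notation: $\{x\}=x-\lfloor x\rfloor$, $B_1(x)=\{x\}-\frac12$, $\mathbb{B}_1(x)=\{x\}-\frac12$ for $x\notin\mathbb{Z}$ and $0$ for $x\in\mathbb{Z}$, $\delta_0(x)=1$ if $x\in\mathbb{Z}$ and $0$ otherwise. For $(a,b)\in\mathbb{Z}_{\mathscr N}^2\setminus\mathbb{Z}^2$ and $g=[(a,b)+\mathbb{Z}^2]$: $\pi_c(g)=B_1(bc)\big(cB_1(a)-B_1(ac)\big)$, $\Psi(g)=\pi_c(g)+\frac12\big(c^2\delta_0(a)\mathbb{B}_1(b)-\delta_0(ca)\mathbb{B}_1(cb)\big)$, and $\Psi^\delta(g)=\sum_{D\mid N}n_D\Psi([(a,bD)+\mathbb{Z}^2])$. $\Psi^\delta$ is the $\mathbb{Q}$-valued distribution on test functions (supported away from $0$, in the restricted tensor product over primes $\ell\nmid cN$) that is invariant under scalar matrices and has these values on the generators $[(a,b)+\mathbb{Z}^2]$.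 -}

module Defs where

open import Data.Nat as ℕ using (ℕ; suc)
open import Data.Nat.Divisibility using (_∣?_)
open import Data.Integer as ℤ using (ℤ; +_)
open import Data.Rational as ℚ using (ℚ; _+_; _-_; _*_; ½; 0ℚ; floor; ↧ₙ_)
open import Data.List using (List; filter; map; upTo; foldr)
open import Data.Bool using (if_then_else_)
open import Relation.Nullary.Decidable using (does)
open import Relation.Binary.PropositionalEquality using (_≡_)

ℤtoℚ : ℤ → ℚ
ℤtoℚ z = z ℚ./ 1

ℕtoℚ : ℕ → ℚ
ℕtoℚ n = ℤtoℚ (+ n)

IsInt : ℚ → Set
IsInt x = ↧ₙ x ≡ 1

δ₀ : ℚ → ℚ
δ₀ x = if does (↧ₙ x ℕ.≟ 1) then ℚ.1ℚ else 0ℚ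

frac : ℚ → ℚ
frac x = x - ℤtoℚ (floor x)

B₁ : ℚ → ℚ
B₁ x = frac x - ½

𝔹₁ : ℚ → ℚ
𝔹₁ x = if does (↧ₙ x ℕ.≟ 1) then 0ℚ else B₁ x

πc : ℕ → ℚ → ℚ → ℚ
πc c a b = B₁ (b * ℕtoℚ c) * (ℕtoℚ c * B₁ a - B₁ (a * ℕtoℚ c))

Ψ : ℕ → ℚ → ℚ → ℚ
Ψ c a b = πc c a b
        + ½ * (ℕtoℚ c * ℕtoℚ c * δ₀ a * 𝔹₁ b
               - δ₀ (ℕtoℚ c * a) * 𝔹₁ (ℕtoℚ c * b))

divisors : ℕ → List ℕ
divisors N = filter (_∣? N) (map suc (upTo N))

sumℚ : List ℚ → ℚ
sumℚ = foldr _+_ 0ℚ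

sumℤ : List ℤ → ℤ
sumℤ = foldr ℤ._+_ (+ 0)

-- δ = Σ_{D ∣ N} n_D [diag(1,D)], coefficients given by n : ℕ → ℤ (only
-- the values at positive divisors of N matter).
-- Ψ^δ([(a,b)]) = Σ_{D ∣ N} n_D Ψ([(a, bD)])
Ψδ : ℕ → ℕ → (ℕ → ℤ) → ℚ → ℚ → ℚ
Ψδ c N n a b = sumℚ (map (λ D → ℤtoℚ (n D) * Ψ c a (b * ℕtoℚ D)) (divisors N))

DegreeZero : ℕ → (ℕ → ℤ) → Set
DegreeZero N n = sumℤ (map (λ D → n D ℤ.* + D) (divisors N)) ≡ + 0

{-# OPTIONS --safe #-}
module Submission where

-- Put K = c B₁(a) − B₁(ac). Then 6K ∈ ℤ, and modulo ℤ one has B₁(x) ≡ x − ½ and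
-- 𝔹₁(x) = B₁(x) + ½ δ₀(x), with δ₀(x) ∈ {0, 1}. Hence every coefficient that multiplies a
-- B₁ or 𝔹₁ in 12 Ψ is twice an integer, and 12 Ψ([(a, y)]) ≡ λ(a) y (mod ℤ) with λ(a)
-- independent of y. Summing with weights n_D gives 12 Ψ^δ ≡ λ(a) b Σ n_D D = 0 (mod ℤ).
-- Only the degree condition enters.

open import Defs

-- Anonymous so that ℚ's _*_ stays out of scope in the statement of mainTheorem17.
module _ where
  open import Data.Nat as ℕ using (ℕ; suc)
  open import Data.Nat.DivMod using (n/1≡n; n%1≡0)
  import Data.Nat.Coprimality as Coprimality
  open import Data.Integer as ℤ using (ℤ; +_; -[1+_])
  import Data.Integer.Properties as ℤ
  open import Data.Rational using (ℚ; mkℚ; 0ℚ; 1ℚ; ½; _+_; _-_; _*_; -_; floor; ↧ₙ_)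
  import Data.Rational.Properties as ℚ
  open import Data.Rational.Solver using (module +-*-Solver)
  open import Data.List using (List; []; _∷_; map)
  open import Data.Product using (∃; _,_)
  open import Data.Bool using (if_then_else_)
  open import Function using (_∘_)
  open import Relation.Nullary using (Dec; yes; no)
  open import Relation.Nullary.Decidable using (does)
  open import Relation.Binary.PropositionalEquality
  open +-*-Solver using (Polynomial; solve; _:=_; _:+_; _:-_; :-_; _:*_; con)

  ℤtoℚ≡mkℚ : ∀ k → ℤtoℚ k ≡ mkℚ k 0 (Coprimality.sym (Coprimality.1-coprimeTo ℤ.∣ k ∣))
  ℤtoℚ≡mkℚ k = ℚ.↥p/↧p≡p (mkℚ k 0 _)

  ℤtoℚ-+ : ∀ k l → ℤtoℚ (k ℤ.+ l) ≡ ℤtoℚ k + ℤtoℚ l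
  ℤtoℚ-+ k l rewrite ℤtoℚ≡mkℚ k | ℤtoℚ≡mkℚ l =
    cong ℤtoℚ (sym (cong₂ ℤ._+_ (ℤ.*-identityʳ k) (ℤ.*-identityʳ l)))

  ℤtoℚ-* : ∀ k l → ℤtoℚ (k ℤ.* l) ≡ ℤtoℚ k * ℤtoℚ l
  ℤtoℚ-* k l rewrite ℤtoℚ≡mkℚ k | ℤtoℚ≡mkℚ l = refl

  ℤtoℚ-neg : ∀ k → ℤtoℚ (ℤ.- k) ≡ - ℤtoℚ k
  ℤtoℚ-neg (+ 0) = refl
  ℤtoℚ-neg (+ suc n) rewrite ℤtoℚ≡mkℚ (+ suc n) = refl
  ℤtoℚ-neg -[1+ n ] rewrite ℤtoℚ≡mkℚ (+ suc n) = refl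

  ℤtoℚ-sumℤ : (w : ℕ → ℤ) (L : List ℕ) → ℤtoℚ (sumℤ (map w L)) ≡ sumℚ (map (ℤtoℚ ∘ w) L)
  ℤtoℚ-sumℤ w [] = refl
  ℤtoℚ-sumℤ w (D ∷ L) = trans (ℤtoℚ-+ (w D) _) (cong (_+_ (ℤtoℚ (w D))) (ℤtoℚ-sumℤ w L))

  k/1≡k : ∀ k → k ℤ./ + 1 ≡ k
  k/1≡k k = trans (ℤ.*-identityˡ (k ℤ./ℕ 1)) (k/ℕ1≡k k)
    where
    k/ℕ1≡k : ∀ k → k ℤ./ℕ 1 ≡ k
    k/ℕ1≡k (+ n) = cong +_ (n/1≡n n)
    k/ℕ1≡k -[1+ n ] rewrite n%1≡0 (suc n) | n/1≡n (suc n) = refl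

  IsInt-ℤtoℚ : ∀ k → IsInt (ℤtoℚ k)
  IsInt-ℤtoℚ k rewrite ℤtoℚ≡mkℚ k = refl

  IsInt⇒ℤtoℚ-floor≡id : ∀ {x} → IsInt x → ℤtoℚ (floor x) ≡ x
  IsInt⇒ℤtoℚ-floor≡id {mkℚ k 0 _} refl = trans (cong ℤtoℚ (k/1≡k k)) (ℚ.↥p/↧p≡p _)

  Integral : ℚ → Set
  Integral x = ∃ λ k → x ≡ ℤtoℚ k

  Integral⇒IsInt : ∀ {x} → Integral x → IsInt x
  Integral⇒IsInt (k , refl) = IsInt-ℤtoℚ k

  integral-ℤtoℚ : ∀ k → Integral (ℤtoℚ k)
  integral-ℤtoℚ k = k , refl

  integral-ℕtoℚ : ∀ n → Integral (ℕtoℚ n)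
  integral-ℕtoℚ n = integral-ℤtoℚ (+ n)

  integral-+ : ∀ {x y} → Integral x → Integral y → Integral (x + y)
  integral-+ (k , refl) (l , refl) = k ℤ.+ l , sym (ℤtoℚ-+ k l)

  integral-* : ∀ {x y} → Integral x → Integral y → Integral (x * y)
  integral-* (k , refl) (l , refl) = k ℤ.* l , sym (ℤtoℚ-* k l)

  integral-neg : ∀ {x} → Integral x → Integral (- x)
  integral-neg (k , refl) = ℤ.- k , sym (ℤtoℚ-neg k)

  integral-- : ∀ {x y} → Integral x → Integral y → Integral (x - y)
  integral-- p q = integral-+ p (integral-neg q)

  δ₀-integral : ∀ x → Integral (δ₀ x)
  δ₀-integral x = integral-if (↧ₙ x ℕ.≟ 1)
    where
    integral-if : (d : Dec (IsInt x)) → Integral (if does d then 1ℚ else 0ℚ)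
    integral-if (yes _) = + 1 , refl
    integral-if (no _) = + 0 , refl

  𝔹₁≡B₁+½δ₀ : ∀ x → 𝔹₁ x ≡ B₁ x + ½ * δ₀ x
  𝔹₁≡B₁+½δ₀ x = by-cases (↧ₙ x ℕ.≟ 1)
    where
    by-cases : (d : Dec (IsInt x)) →
      (if does d then 0ℚ else B₁ x) ≡ B₁ x + ½ * (if does d then 1ℚ else 0ℚ)
    by-cases (yes x∈ℤ) = trans
      (solve 1 (λ x → con 0ℚ := ((x :- x) :- con ½) :+ con ½ :* con 1ℚ) refl x)
      (cong (λ t → ((x - t) - ½) + ½ * 1ℚ) (sym (IsInt⇒ℤtoℚ-floor≡id x∈ℤ)))
    by-cases (no _) = solve 1 (λ b → b := b :+ con ½ :* con 0ℚ) refl (B₁ x)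

  -- A record, not an abbreviation for Integral (x - y), so that x and y are inferable.
  infix 4 _≈ℤ_
  record _≈ℤ_ (x y : ℚ) : Set where
    constructor mod-ℤ
    field difference-integral : Integral (x - y)
  open _≈ℤ_

  lit : ∀ {m} → ℕ → Polynomial m
  lit n = con (ℕtoℚ n)

  ≈ℤ-+ : ∀ {x y u v} → x ≈ℤ y → u ≈ℤ v → x + u ≈ℤ y + v
  ≈ℤ-+ {x} {y} {u} {v} (mod-ℤ p) (mod-ℤ q) = mod-ℤ (subst Integral
    (solve 4 (λ x y u v → (x :- y) :+ (u :- v) := (x :+ u) :- (y :+ v)) refl x y u v)
    (integral-+ p q))

  ≈ℤ-- : ∀ {x y u v} → x ≈ℤ y → u ≈ℤ v → x - u ≈ℤ y - v
  ≈ℤ-- {x} {y} {u} {v} (mod-ℤ p) (mod-ℤ q) = mod-ℤ (subst Integral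
    (solve 4 (λ x y u v → (x :- y) :- (u :- v) := (x :- u) :- (y :- v)) refl x y u v)
    (integral-- p q))

  ≈ℤ-*ˡ : ∀ {k x y} → Integral k → x ≈ℤ y → k * x ≈ℤ k * y
  ≈ℤ-*ˡ {k} {x} {y} p (mod-ℤ q) = mod-ℤ (subst Integral
    (solve 3 (λ k x y → k :* (x :- y) := k :* x :- k :* y) refl k x y)
    (integral-* p q))

  two*B₁≈two*id : ∀ {t} x → Integral t → ℕtoℚ 2 * t * B₁ x ≈ℤ ℕtoℚ 2 * t * x
  two*B₁≈two*id {t} x t∈ℤ = mod-ℤ (subst Integral
    (solve 3 (λ t x f → :- (lit 2 :* t :* f) :- t
                        := lit 2 :* t :* ((x :- f) :- con ½) :- lit 2 :* t :* x)
      refl t x (ℤtoℚ (floor x)))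
    (integral-- (integral-neg (integral-* (integral-* (integral-ℕtoℚ 2) t∈ℤ)
                                          (integral-ℤtoℚ (floor x))))
                t∈ℤ))

  two*𝔹₁≈two*id : ∀ {t} x → Integral t → ℕtoℚ 2 * t * 𝔹₁ x ≈ℤ ℕtoℚ 2 * t * x
  two*𝔹₁≈two*id {t} x t∈ℤ = mod-ℤ (subst Integral
    (trans (solve 4 (λ t x b d → (lit 2 :* t :* b :- lit 2 :* t :* x) :+ t :* d
                                 := lit 2 :* t :* (b :+ con ½ :* d) :- lit 2 :* t :* x)
             refl t x (B₁ x) (δ₀ x))
           (cong (λ z → ℕtoℚ 2 * t * z - ℕtoℚ 2 * t * x) (sym (𝔹₁≡B₁+½δ₀ x))))
    (integral-+ (difference-integral (two*B₁≈two*id x t∈ℤ)) (integral-* t∈ℤ (δ₀-integral x))))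

  πcoeff : ℕ → ℚ → ℚ
  πcoeff c a = ℕtoℚ c * B₁ a - B₁ (a * ℕtoℚ c)

  six*πcoeff-integral : ∀ c a → Integral (ℕtoℚ 6 * πcoeff c a)
  six*πcoeff-integral c a = subst Integral
    (sym (solve 4 (λ c a f g → lit 6 :* (c :* ((a :- f) :- con ½) :- ((a :* c :- g) :- con ½))
                               := lit 6 :* g :- lit 6 :* c :* f :- lit 3 :* c :+ lit 3)
           refl (ℕtoℚ c) a (ℤtoℚ (floor a)) (ℤtoℚ (floor (a * ℕtoℚ c)))))
    (integral-+ (integral-- (integral-- (integral-* six (integral-ℤtoℚ (floor (a * ℕtoℚ c))))
                                        (integral-* (integral-* six c∈ℤ) (integral-ℤtoℚ (floor a))))
                            (integral-* (integral-ℕtoℚ 3) c∈ℤ))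
                (integral-ℕtoℚ 3))
    where
    six = integral-ℕtoℚ 6
    c∈ℤ = integral-ℕtoℚ c

  slope : ℕ → ℚ → ℚ
  slope c a = ℕtoℚ 12 * πcoeff c a * γ + ℕtoℚ 6 * (γ * γ * δ₀ a) - ℕtoℚ 6 * δ₀ (γ * a) * γ
    where γ = ℕtoℚ c

  twelve*Ψ≈slope*y : ∀ c a y → ℕtoℚ 12 * Ψ c a y ≈ℤ slope c a * y
  twelve*Ψ≈slope*y c a y = subst₂ _≈ℤ_ (sym expand) collect
    (≈ℤ-- (≈ℤ-+ (two*B₁≈two*id (y * γ) (six*πcoeff-integral c a))
                (two*𝔹₁≈two*id y three*C-integral))
          (two*𝔹₁≈two*id (γ * y) three*E-integral))
    where
    γ = ℕtoℚ c
    K = πcoeff c a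
    C = γ * γ * δ₀ a
    E = δ₀ (γ * a)
    three*C-integral : Integral (ℕtoℚ 3 * C)
    three*C-integral = integral-* (integral-ℕtoℚ 3)
      (integral-* (integral-* (integral-ℕtoℚ c) (integral-ℕtoℚ c)) (δ₀-integral a))
    three*E-integral : Integral (ℕtoℚ 3 * E)
    three*E-integral = integral-* (integral-ℕtoℚ 3) (δ₀-integral (γ * a))
    expand : ℕtoℚ 12 * Ψ c a y
           ≡ ℕtoℚ 2 * (ℕtoℚ 6 * K) * B₁ (y * γ) + ℕtoℚ 2 * (ℕtoℚ 3 * C) * 𝔹₁ y
             - ℕtoℚ 2 * (ℕtoℚ 3 * E) * 𝔹₁ (γ * y)
    expand = solve 6 (λ P K C E Q R →
        lit 12 :* (P :* K :+ con ½ :* (C :* Q :- E :* R))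
        := lit 2 :* (lit 6 :* K) :* P :+ lit 2 :* (lit 3 :* C) :* Q :- lit 2 :* (lit 3 :* E) :* R)
      refl (B₁ (y * γ)) K C E (𝔹₁ y) (𝔹₁ (γ * y))
    collect : ℕtoℚ 2 * (ℕtoℚ 6 * K) * (y * γ) + ℕtoℚ 2 * (ℕtoℚ 3 * C) * y
              - ℕtoℚ 2 * (ℕtoℚ 3 * E) * (γ * y)
            ≡ slope c a * y
    collect = solve 5 (λ γ K C E y →
        lit 2 :* (lit 6 :* K) :* (y :* γ) :+ lit 2 :* (lit 3 :* C) :* y
          :- lit 2 :* (lit 3 :* E) :* (γ :* y)
        := (lit 12 :* K :* γ :+ lit 6 :* C :- lit 6 :* E :* γ) :* y)
      refl γ K C E y

  ≈ℤ-sum : ∀ r s (f g : ℕ → ℚ) → (∀ D → r * f D ≈ℤ s * g D) →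
           ∀ L → r * sumℚ (map f L) ≈ℤ s * sumℚ (map g L)
  ≈ℤ-sum r s f g termwise [] =
    mod-ℤ (+ 0 , solve 2 (λ r s → r :* con 0ℚ :- s :* con 0ℚ := con 0ℚ) refl r s)
  ≈ℤ-sum r s f g termwise (D ∷ L) =
    subst₂ _≈ℤ_ (sym (ℚ.*-distribˡ-+ r (f D) _)) (sym (ℚ.*-distribˡ-+ s (g D) _))
      (≈ℤ-+ (termwise D) (≈ℤ-sum r s f g termwise L))

  twelve*nΨ≈slope*b*nD : ∀ c a b (k : ℤ) D →
    ℕtoℚ 12 * (ℤtoℚ k * Ψ c a (b * ℕtoℚ D)) ≈ℤ slope c a * b * ℤtoℚ (k ℤ.* + D)
  twelve*nΨ≈slope*b*nD c a b k D =
    subst₂ _≈ℤ_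
      (solve 2 (λ k P → k :* (lit 12 :* P) := lit 12 :* (k :* P)) refl (ℤtoℚ k) (Ψ c a y))
      (trans (solve 4 (λ k λ' b D → k :* (λ' :* (b :* D)) := λ' :* b :* (k :* D))
               refl (ℤtoℚ k) (slope c a) b (ℕtoℚ D))
             (cong (slope c a * b *_) (sym (ℤtoℚ-* k (+ D)))))
      (≈ℤ-*ˡ (integral-ℤtoℚ k) (twelve*Ψ≈slope*y c a y))
    where y = b * ℕtoℚ D

  twelve*Ψδ-integral : ∀ c N n a b → DegreeZero N n → IsInt (ℕtoℚ 12 * Ψδ c N n a b)
  twelve*Ψδ-integral c N n a b deg =
    Integral⇒IsInt (subst Integral vanish (difference-integral summed))
    where
    w : ℕ → ℤ
    w D = n D ℤ.* + D
    degree : sumℚ (map (ℤtoℚ ∘ w) (divisors N)) ≡ 0ℚ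
    degree = trans (sym (ℤtoℚ-sumℤ w (divisors N))) (cong ℤtoℚ deg)
    summed : ℕtoℚ 12 * Ψδ c N n a b ≈ℤ slope c a * b * sumℚ (map (ℤtoℚ ∘ w) (divisors N))
    summed = ≈ℤ-sum (ℕtoℚ 12) (slope c a * b) _ (ℤtoℚ ∘ w)
               (λ D → twelve*nΨ≈slope*b*nD c a b (n D) D) (divisors N)
    vanish : ℕtoℚ 12 * Ψδ c N n a b - slope c a * b * sumℚ (map (ℤtoℚ ∘ w) (divisors N))
           ≡ ℕtoℚ 12 * Ψδ c N n a b
    vanish rewrite degree =
      solve 2 (λ x s → x :- s :* con 0ℚ := x) refl (ℕtoℚ 12 * Ψδ c N n a b) (slope c a * b)

open import Data.Nat using (ℕ; _<_; _*_)
open import Data.Nat.Coprimality using (Coprime)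
open import Data.Integer using (ℤ)
open import Data.Rational using (ℚ; ↧ₙ_)
open import Data.Product using (_×_)
open import Relation.Nullary using (¬_)

mainTheorem17 : (c N : ℕ) → 1 < c → Coprime c 6 → 1 < N → Coprime N c →
    (n : ℕ → ℤ) → DegreeZero N n →
    (a b : ℚ) → Coprime (↧ₙ a) (c * N) → Coprime (↧ₙ b) (c * N) →
    ¬ (IsInt a × IsInt b) →
    IsInt (ℕtoℚ 12 Data.Rational.* Ψδ c N n a b)
mainTheorem17 c N _ _ _ _ n deg a b _ _ _ = twelve*Ψδ-integral c N n a b deg
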